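{- Let $u_0\geq 1$ and $r\geq 2$ be integers with $\gcd(u_0,r)=1$, let $n\geq 0$ be an integer, and set $u_j:=u_0+jr$ for integers $j$ and $L_n:=\operatorname{lcm}(u_0,u_1,\ldots,u_n)$. Then for every integer $k$ with $0\leq k\leq n$, $$L_n \geq r^{\frac{(n-k)r}{r-1}}\binom{\frac{u_{k-1}}{r} + (n-k+1)}{n-k+1},$$ where $u_{k-1}=u_0+(k-1)r$.
   Context: For a real number $x$ and an integer $N\geq 0$, the binomial coefficient is defined by $\binom{x}{N}:=\frac{x(x-1)\cdots(x-N+1)}{N!}$ (so it may be applied with non-integer $x$). -}

module Defs where

open import Data.Nat using (ℕ; zero; suc)
import Data.Nat as ℕ
open import Data.Nat.LCM using (lcm)
open import Data.Integer using (ℤ; +_)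
import Data.Integer as ℤ
open import Data.Rational using (ℚ; _/_; _*_; _-_; _+_; 0ℚ; 1ℚ)
open import Data.List using (List; foldr; map; upTo)

ℕ→ℚ : ℕ → ℚ
ℕ→ℚ m = + m / 1

-- integer divided by a natural number as a rational (division by 0 gives 0; never used)
_/ℕ_ : ℤ → ℕ → ℚ
z /ℕ zero  = 0ℚ
z /ℕ suc m = z / suc m

_^ℚ_ : ℚ → ℕ → ℚ
p ^ℚ zero  = 1ℚ
p ^ℚ suc m = p * (p ^ℚ m)

-- generalized binomial coefficient  binom x N = x(x-1)...(x-N+1)/N!
binomℚ : ℚ → ℕ → ℚ
binomℚ x zero    = 1ℚ
binomℚ x (suc N) = binomℚ x N * (x - ℕ→ℚ N) * (+ 1 / suc N)

u : ℕ → ℕ → ℤ → ℤ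
u u0 r j = + u0 ℤ.+ j ℤ.* + r

L : ℕ → ℕ → ℕ → ℕ
L u0 r n = foldr lcm 1 (map (λ j → u0 ℕ.+ j ℕ.* r) (upTo (suc n)))

{-# OPTIONS --safe #-}
-- Put M = n - k and P = u_k u_(k+1) ⋯ u_n.  Then r^(M+1) (M+1)! binom(u_(k-1)/r + M + 1, M + 1) = P,
-- since r (u_(k-1)/r + M + 1 - j) = u_(k+M-j).  Because gcd(u_a, u_(a+j)) divides j r, induction on
-- the length shows that P divides L_n M! r^M; as P is coprime to r, P r^D ≤ L_n M! whenever r^D ∣ M!.
-- Legendre's formula gives such a D with r^M ≤ (r^D r (M+1))^(r-1) (the base-r digit sum of M is at
-- most (r-1) times its number of digits); multiplying it into (P r^D)^(r-1) ≤ (L_n M!)^(r-1) gives the claim.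
module Submission where

open import Defs
open import Data.Nat using (ℕ; suc; _≤_; _∸_; _*_; _^_)
open import Data.Nat.GCD using (gcd)
open import Data.Integer using (+_; _-_)
import Data.Rational as ℚ
open import Relation.Binary.PropositionalEquality using (_≡_)

open import Data.Nat using (zero; _+_; _<_; z≤n; s≤s; s≤s⁻¹; NonZero; >-nonZero; _!)
open import Data.Nat.Properties
open import Data.Nat.DivMod using (_/_; _%_; m≡m%n+[m/n]*n; m%n<n; m/n*n≤m; m<n*o⇒m/o<n)
open import Data.Nat.Divisibility
open import Data.Nat.GCD using (gcd-comm; gcd-greatest; gcd[m,n]∣m; gcd[m,n]∣n; c*gcd[m,n]≡gcd[cm,cn])
open import Data.Nat.LCM using (lcm; m∣lcm[m,n]; n∣lcm[m,n]; gcd*lcm)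
open import Data.Nat.Coprimality as Coprime using (Coprime; coprime-divisor; 1-coprimeTo; gcd≡1⇒coprime)
open import Data.Nat.Tactic.RingSolver using (solve-∀)
import Data.Integer as ℤ
import Data.Integer.Properties as ℤP
import Data.Integer.Tactic.RingSolver as ℤ-Solver
open import Data.Rational using (ℚ; toℚᵘ)
import Data.Rational.Properties as ℚP
import Data.Rational.Solver as ℚ-Solver
open import Data.Rational.Unnormalised using (mkℚᵘ; *≡*; *≤*)
import Data.Rational.Unnormalised as ℚᵘ
import Data.Rational.Unnormalised.Properties as ℚᵘP
open import Data.List using ([]; _∷_; foldr; map; upTo)
open import Data.List.Membership.Propositional using (_∈_)
open import Data.List.Membership.Propositional.Properties using (∈-map⁺; ∈-upTo⁺)
open import Data.List.Relation.Unary.Any using (here; there)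
open import Data.Product using (∃-syntax; _×_; _,_)
open import Data.Sum using (inj₁; inj₂)
open import Relation.Binary.PropositionalEquality
  using (refl; sym; trans; cong; cong₂; subst; subst₂; module ≡-Reasoning)

^-distribʳ-* : ∀ m n o → (m * n) ^ o ≡ m ^ o * n ^ o
^-distribʳ-* m n zero    = refl
^-distribʳ-* m n (suc o) = begin
  m * n * (m * n) ^ o       ≡⟨ cong (m * n *_) (^-distribʳ-* m n o) ⟩
  m * n * (m ^ o * n ^ o)   ≡⟨ interchange m n (m ^ o) (n ^ o) ⟩
  m * m ^ o * (n * n ^ o)   ∎
  where
  open ≡-Reasoning
  interchange : ∀ a b c d → a * b * (c * d) ≡ a * c * (b * d)
  interchange = solve-∀

lcm≢0 : ∀ m n .{{_ : NonZero m}} .{{_ : NonZero n}} → NonZero (lcm m n)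
lcm≢0 m n = m*n≢0⇒n≢0 (gcd m n) {{subst NonZero (sym (gcd*lcm m n)) (m*n≢0 m n)}}

∈⇒∣foldr-lcm : ∀ {x xs} → x ∈ xs → x ∣ foldr lcm 1 xs
∈⇒∣foldr-lcm {x} {_ ∷ xs} (here refl) = m∣lcm[m,n] x (foldr lcm 1 xs)
∈⇒∣foldr-lcm {x} {y ∷ xs} (there x∈xs) = ∣-trans (∈⇒∣foldr-lcm x∈xs) (n∣lcm[m,n] y (foldr lcm 1 xs))

c*m∣o⇒c*n∣o⇒c*m*n∣o*gcd[m,n] : ∀ c m n {o} → c * m ∣ o → c * n ∣ o → c * m * n ∣ o * gcd m n
c*m∣o⇒c*n∣o⇒c*m*n∣o*gcd[m,n] zero m n cm∣o _ rewrite 0∣⇒≡0 cm∣o = 0 ∣0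
c*m∣o⇒c*n∣o⇒c*m*n∣o*gcd[m,n] c@(suc _) m n {o} cm∣o cn∣o = *-cancelˡ-∣ c (begin
  c * (c * m * n)                 ≡⟨ regroup c m n ⟩
  c * m * (c * n)                 ∣⟨ gcd-greatest (*-monoˡ-∣ (c * n) cm∣o)
                                       (subst (_∣ o * (c * m)) (*-comm (c * n) (c * m)) (*-monoˡ-∣ (c * m) cn∣o)) ⟩
  gcd (o * (c * n)) (o * (c * m)) ≡⟨ c*gcd[m,n]≡gcd[cm,cn] o (c * n) (c * m) ⟨
  o * gcd (c * n) (c * m)         ≡⟨ cong (o *_) (c*gcd[m,n]≡gcd[cm,cn] c n m) ⟨
  o * (c * gcd n m)               ≡⟨ cong (λ g → o * (c * g)) (gcd-comm n m) ⟩
  o * (c * gcd m n)               ≡⟨ *-comm-middle o c (gcd m n) ⟩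
  c * (o * gcd m n)               ∎)
  where
  open ∣-Reasoning
  regroup : ∀ c m n → c * (c * m * n) ≡ c * m * (c * n)
  regroup = solve-∀
  *-comm-middle : ∀ o c g → o * (c * g) ≡ c * (o * g)
  *-comm-middle = solve-∀

*-coprime : ∀ {m n o} → Coprime m o → Coprime n o → Coprime (m * n) o
*-coprime {m} m⊥o n⊥o (d∣mn , d∣o) = n⊥o (coprime-divisor d⊥m d∣mn , d∣o)
  where
  d⊥m : Coprime _ m
  d⊥m (e∣d , e∣m) = m⊥o (e∣m , ∣-trans e∣d d∣o)

coprime-^ : ∀ {m n} → Coprime m n → ∀ e → Coprime m (n ^ e)
coprime-^ {m} m⊥n zero    = Coprime.sym (1-coprimeTo m)
coprime-^ m⊥n (suc e) = Coprime.sym (*-coprime (Coprime.sym m⊥n) (Coprime.sym (coprime-^ m⊥n e)))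

coprime-∣⇒*∣ : ∀ {m n o} → Coprime m n → m ∣ o → n ∣ o → m * n ∣ o
coprime-∣⇒*∣ {m} {n} m⊥n m∣o (divides q refl) =
  *-monoˡ-∣ n (coprime-divisor m⊥n (subst (m ∣_) (*-comm q n) m∣o))

-- Legendre-type bounds

r^q*q!∣[q*r]! : ∀ ρ q → suc ρ ^ q * q ! ∣ (q * suc ρ) !
r^q*q!∣[q*r]! ρ zero    = ∣-refl
r^q*q!∣[q*r]! ρ (suc q) = begin
  r ^ suc q * suc q !       ≡⟨ regroup r (r ^ q) q (q !) ⟩
  suc q * r * (r ^ q * q !) ∣⟨ *-monoʳ-∣ (suc q * r) (∣-trans (r^q*q!∣[q*r]! ρ q) (m≤n⇒m!∣n! (m≤n+m (q * r) ρ))) ⟩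
  (suc q * r) !             ∎
  where
  open ∣-Reasoning
  r = suc ρ
  regroup : ∀ r x q f → r * x * (suc q * f) ≡ suc q * r * (x * f)
  regroup = solve-∀

-- The witness is D = Σᵢ ⌊M / rⁱ⌋: each step peels off the last base-r digit M % r ≤ ρ.
legendre-digit-bound : ∀ ρ ℓ M → M < suc ρ ^ ℓ → ∃[ D ] suc ρ ^ D ∣ M ! × M ≤ ρ * (D + ℓ)
legendre-digit-bound ρ zero    zero    _           = 0 , ∣-refl , z≤n
legendre-digit-bound ρ zero    (suc M) (s≤s ())
legendre-digit-bound ρ (suc ℓ) M M<r^ℓ⁺
  with legendre-digit-bound ρ ℓ (M / suc ρ) (m<n*o⇒m/o<n (subst (M <_) (*-comm (suc ρ) (suc ρ ^ ℓ)) M<r^ℓ⁺))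
... | D , r^D∣q! , q≤ = q + D , r^[q+D]∣M! , M≤
  where
  r = suc ρ
  q = M / r
  r^[q+D]∣M! : r ^ (q + D) ∣ M !
  r^[q+D]∣M! = begin
    r ^ (q + D)   ≡⟨ ^-distribˡ-+-* r q D ⟩
    r ^ q * r ^ D ∣⟨ *-monoʳ-∣ (r ^ q) r^D∣q! ⟩
    r ^ q * q !   ∣⟨ r^q*q!∣[q*r]! ρ q ⟩
    (q * r) !     ∣⟨ m≤n⇒m!∣n! (m/n*n≤m M r) ⟩
    M !           ∎
    where open ∣-Reasoning
  regroup : ∀ ρ D ℓ q → ρ + (ρ * (D + ℓ) + q * ρ) ≡ ρ * (q + D + suc ℓ)
  regroup = solve-∀
  M≤ : M ≤ ρ * (q + D + suc ℓ)
  M≤ = begin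
    M                         ≡⟨ m≡m%n+[m/n]*n M r ⟩
    M % r + q * r             ≡⟨ cong (λ t → M % r + t) (*-suc q ρ) ⟩
    M % r + (q + q * ρ)       ≤⟨ +-mono-≤ (s≤s⁻¹ (m%n<n M r)) (+-monoˡ-≤ (q * ρ) q≤) ⟩
    ρ + (ρ * (D + ℓ) + q * ρ) ≡⟨ regroup ρ D ℓ q ⟩
    ρ * (q + D + suc ℓ)       ∎
    where open ≤-Reasoning

power-bracketing : ∀ r → 1 < r → ∀ M → ∃[ ℓ ] M < r ^ ℓ × r ^ ℓ ≤ r * suc M
power-bracketing r@(suc _) 1<r zero = 0 , s≤s z≤n , s≤s z≤n
power-bracketing r 1<r (suc M) with power-bracketing r 1<r M
... | ℓ , M<r^ℓ , r^ℓ≤ with m≤n⇒m<n∨m≡n M<r^ℓ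
...   | inj₁ 1+M<r^ℓ = ℓ , 1+M<r^ℓ , ≤-trans r^ℓ≤ (*-monoʳ-≤ r (n≤1+n (suc M)))
...   | inj₂ 1+M≡r^ℓ = suc ℓ
  , subst (λ t → suc M < r * t) 1+M≡r^ℓ (subst (suc M <_) (*-comm (suc M) r) (m<m*n (suc M) r 1<r))
  , subst (λ t → r * t ≤ r * suc (suc M)) 1+M≡r^ℓ (*-monoʳ-≤ r (n≤1+n (suc M)))

legendre-bound : ∀ ρ → 1 ≤ ρ → ∀ M → ∃[ D ] suc ρ ^ D ∣ M ! × suc ρ ^ M ≤ (suc ρ ^ D * (suc ρ * suc M)) ^ ρ
legendre-bound ρ 1≤ρ M with power-bracketing (suc ρ) (s≤s 1≤ρ) M
... | ℓ , M<r^ℓ , r^ℓ≤ with legendre-digit-bound ρ ℓ M M<r^ℓ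
... | D , r^D∣M! , M≤ = D , r^D∣M! , (begin
  r ^ M                     ≤⟨ ^-monoʳ-≤ r M≤ ⟩
  r ^ (ρ * (D + ℓ))         ≡⟨ cong (r ^_) (*-comm ρ (D + ℓ)) ⟩
  r ^ ((D + ℓ) * ρ)         ≡⟨ ^-*-assoc r (D + ℓ) ρ ⟨
  (r ^ (D + ℓ)) ^ ρ         ≡⟨ cong (_^ ρ) (^-distribˡ-+-* r D ℓ) ⟩
  (r ^ D * r ^ ℓ) ^ ρ       ≤⟨ ^-monoˡ-≤ ρ (*-monoʳ-≤ (r ^ D) r^ℓ≤) ⟩
  (r ^ D * (r * suc M)) ^ ρ ∎)
  where
  open ≤-Reasoning
  r = suc ρ

scaled-product-bound : ∀ ρ M D P N → P * suc ρ ^ D ≤ N * M ! →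
  suc ρ ^ M ≤ (suc ρ ^ D * (suc ρ * suc M)) ^ ρ →
  suc ρ ^ (M * suc ρ) * P ^ ρ ≤ (N * (suc ρ ^ suc M * suc M !)) ^ ρ
scaled-product-bound ρ M D P N P*r^D≤N*M! r^M≤ = begin
  r ^ (M * r) * P ^ ρ                         ≡⟨ split ⟩
  r ^ M * (r ^ M * P) ^ ρ                     ≤⟨ *-monoˡ-≤ ((r ^ M * P) ^ ρ) r^M≤ ⟩
  (r ^ D * (r * suc M)) ^ ρ * (r ^ M * P) ^ ρ ≡⟨ ^-distribʳ-* (r ^ D * (r * suc M)) (r ^ M * P) ρ ⟨
  (r ^ D * (r * suc M) * (r ^ M * P)) ^ ρ     ≡⟨ cong (_^ ρ) (regroup r (r ^ D) (r ^ M) (suc M) P) ⟩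
  (P * r ^ D * (r ^ suc M * suc M)) ^ ρ       ≤⟨ ^-monoˡ-≤ ρ (*-monoˡ-≤ (r ^ suc M * suc M) P*r^D≤N*M!) ⟩
  (N * M ! * (r ^ suc M * suc M)) ^ ρ         ≡⟨ cong (_^ ρ) (regroup′ N (M !) (r ^ suc M) (suc M)) ⟩
  (N * (r ^ suc M * suc M !)) ^ ρ             ∎
  where
  open ≤-Reasoning
  r = suc ρ
  regroup : ∀ r a b m P → a * (r * m) * (b * P) ≡ P * a * (r * b * m)
  regroup = solve-∀
  regroup′ : ∀ N f x m → N * f * (x * m) ≡ N * (x * (m * f))
  regroup′ = solve-∀
  split : r ^ (M * r) * P ^ ρ ≡ r ^ M * (r ^ M * P) ^ ρ
  split = begin-equality
    r ^ (M * r) * P ^ ρ             ≡⟨ cong (λ e → r ^ e * P ^ ρ) (*-suc M ρ) ⟩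
    r ^ (M + M * ρ) * P ^ ρ         ≡⟨ cong (_* P ^ ρ) (^-distribˡ-+-* r M (M * ρ)) ⟩
    r ^ M * r ^ (M * ρ) * P ^ ρ     ≡⟨ cong (λ x → r ^ M * x * P ^ ρ) (^-*-assoc r M ρ) ⟨
    r ^ M * (r ^ M) ^ ρ * P ^ ρ     ≡⟨ *-assoc (r ^ M) ((r ^ M) ^ ρ) (P ^ ρ) ⟩
    r ^ M * ((r ^ M) ^ ρ * P ^ ρ)   ≡⟨ cong (r ^ M *_) (^-distribʳ-* (r ^ M) P ρ) ⟨
    r ^ M * (r ^ M * P) ^ ρ         ∎

-- Products of consecutive terms of an arithmetic progression

module Progression (u₀ r : ℕ) where

  term : ℕ → ℕ
  term a = u₀ + a * r

  ∏terms : ℕ → ℕ → ℕ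
  ∏terms a zero    = 1
  ∏terms a (suc j) = term a * ∏terms (suc a) j

  ∏terms-suc : ∀ a j → ∏terms a (suc j) ≡ ∏terms a j * term (a + j)
  ∏terms-suc a zero    = trans (*-comm (term a) 1) (cong (λ i → 1 * term i) (sym (+-identityʳ a)))
  ∏terms-suc a (suc j) = begin
    term a * ∏terms (suc a) (suc j)                ≡⟨ cong (term a *_) (∏terms-suc (suc a) j) ⟩
    term a * (∏terms (suc a) j * term (suc a + j)) ≡⟨ *-assoc (term a) _ _ ⟨
    ∏terms a (suc j) * term (suc a + j)            ≡⟨ cong (λ i → ∏terms a (suc j) * term i) (+-suc a j) ⟨
    ∏terms a (suc j) * term (a + suc j)            ∎
    where open ≡-Reasoning

  ∏terms∣*!*^ : ∀ {N} j a → (∀ i → i ≤ j → term (a + i) ∣ N) → ∏terms a (suc j) ∣ N * j ! * r ^ j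
  ∏terms∣*!*^ {N} zero a terms∣N = subst₂ _∣_
    (trans (cong term (+-identityʳ a)) (sym (*-identityʳ (term a))))
    (sym (trans (*-identityʳ (N * 1)) (*-identityʳ N)))
    (terms∣N 0 z≤n)
  ∏terms∣*!*^ {N} (suc j) a terms∣N = begin
    ∏terms a (suc (suc j))          ≡⟨ cong (term a *_) (∏terms-suc (suc a) j) ⟩
    x * (C * y)                     ≡⟨ regroup x C y ⟩
    C * x * y                       ∣⟨ c*m∣o⇒c*n∣o⇒c*m*n∣o*gcd[m,n] C x y C*x∣Z C*y∣Z ⟩
    Z * gcd x y                     ∣⟨ *-monoʳ-∣ Z gcd∣[1+j]*r ⟩
    Z * (suc j * r)                 ≡⟨ regroup′ N (j !) (r ^ j) j r ⟩
    N * suc j ! * r ^ suc j         ∎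
    where
    open ∣-Reasoning
    C = ∏terms (suc a) j
    x = term a
    y = term (suc a + j)
    Z = N * j ! * r ^ j
    regroup : ∀ x C y → x * (C * y) ≡ C * x * y
    regroup = solve-∀
    regroup′ : ∀ N f p j r → N * f * p * (suc j * r) ≡ N * (suc j * f) * (r * p)
    regroup′ = solve-∀
    C*x∣Z : C * x ∣ Z
    C*x∣Z = subst (_∣ Z) (*-comm x C) (∏terms∣*!*^ j a (λ i i≤j → terms∣N i (m≤n⇒m≤1+n i≤j)))
    C*y∣Z : C * y ∣ Z
    C*y∣Z = subst (_∣ Z) (∏terms-suc (suc a) j)
      (∏terms∣*!*^ j (suc a) (λ i i≤j → subst (λ t → term t ∣ N) (+-suc a i) (terms∣N (suc i) (s≤s i≤j))))
    y-expand : ∀ u a j r → u + (suc a + j) * r ≡ u + a * r + suc j * r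
    y-expand = solve-∀
    gcd∣[1+j]*r : gcd x y ∣ suc j * r
    gcd∣[1+j]*r = ∣m+n∣m⇒∣n (subst (gcd x y ∣_) (y-expand u₀ a j r) (gcd[m,n]∣n x y)) (gcd[m,n]∣m x y)

  term-coprime : Coprime u₀ r → ∀ a → Coprime (term a) r
  term-coprime u₀⊥r a {d} (d∣term , d∣r) =
    u₀⊥r (∣m+n∣m⇒∣n (subst (d ∣_) (+-comm u₀ (a * r)) d∣term) (∣n⇒∣m*n a d∣r) , d∣r)

  ∏terms-coprime : Coprime u₀ r → ∀ a j → Coprime (∏terms a j) r
  ∏terms-coprime u₀⊥r a zero    = 1-coprimeTo r
  ∏terms-coprime u₀⊥r a (suc j) = *-coprime (term-coprime u₀⊥r a) (∏terms-coprime u₀⊥r (suc a) j)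

  term∣L : ∀ n i → i ≤ n → term i ∣ L u₀ r n
  term∣L n i i≤n = ∈⇒∣foldr-lcm (∈-map⁺ term (∈-upTo⁺ (s≤s i≤n)))

  L≢0 : 1 ≤ u₀ → ∀ n → NonZero (L u₀ r n)
  L≢0 1≤u₀ n = foldr-lcm-terms≢0 (upTo (suc n))
    where
    foldr-lcm-terms≢0 : ∀ as → NonZero (foldr lcm 1 (map term as))
    foldr-lcm-terms≢0 []       = _
    foldr-lcm-terms≢0 (a ∷ as) = lcm≢0 (term a) _
      {{>-nonZero (≤-trans 1≤u₀ (m≤m+n u₀ (a * r)))}} {{foldr-lcm-terms≢0 as}}

open Progression

∏terms-bound : ∀ u₀ ρ k M → 1 ≤ u₀ → 1 ≤ ρ → Coprime u₀ (suc ρ) →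
  suc ρ ^ (M * suc ρ) * ∏terms u₀ (suc ρ) k (suc M) ^ ρ ≤ (L u₀ (suc ρ) (k + M) * (suc ρ ^ suc M * suc M !)) ^ ρ
∏terms-bound u₀ ρ k M 1≤u₀ 1≤ρ u₀⊥r with legendre-bound ρ 1≤ρ M
... | D , r^D∣M! , r^M≤ = scaled-product-bound ρ M D P Lₙ P*r^D≤L*M! r^M≤
  where
  r = suc ρ
  P = ∏terms u₀ r k (suc M)
  Lₙ = L u₀ r (k + M)
  P⊥r : Coprime P r
  P⊥r = ∏terms-coprime u₀ r u₀⊥r k (suc M)
  P∣L*M!*r^M : P ∣ Lₙ * M ! * r ^ M
  P∣L*M!*r^M = ∏terms∣*!*^ u₀ r M k (λ i i≤M → term∣L u₀ r (k + M) (k + i) (+-monoʳ-≤ k i≤M))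
  P∣L*M! : P ∣ Lₙ * M !
  P∣L*M! = coprime-divisor (coprime-^ P⊥r M) (subst (P ∣_) (*-comm (Lₙ * M !) (r ^ M)) P∣L*M!*r^M)
  P*r^D≤L*M! : P * r ^ D ≤ Lₙ * M !
  P*r^D≤L*M! = ∣⇒≤ {{m*n≢0 Lₙ (M !) {{L≢0 u₀ r 1≤u₀ (k + M)}} {{M !≢0}}}}
    (coprime-∣⇒*∣ (coprime-^ P⊥r D) P∣L*M! (∣-trans r^D∣M! (n∣m*n Lₙ)))

-- Transfer to the rationals

ℤ→ℚ : ℤ.ℤ → ℚ
ℤ→ℚ z = z ℚ./ 1

toℚᵘ-/ : ∀ z d → toℚᵘ (z ℚ./ suc d) ℚᵘ.≃ mkℚᵘ z d
toℚᵘ-/ z d = ℚP.toℚᵘ-fromℚᵘ (mkℚᵘ z d)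

ℤ→ℚ-+ : ∀ a b → ℤ→ℚ (a ℤ.+ b) ≡ ℤ→ℚ a ℚ.+ ℤ→ℚ b
ℤ→ℚ-+ a b = ℚP.toℚᵘ-injective (begin
  toℚᵘ (ℤ→ℚ (a ℤ.+ b))           ≈⟨ toℚᵘ-/ (a ℤ.+ b) 0 ⟩
  mkℚᵘ (a ℤ.+ b) 0               ≈⟨ *≡* (cross-multiplied a b) ⟩
  mkℚᵘ a 0 ℚᵘ.+ mkℚᵘ b 0         ≈⟨ ℚᵘP.+-cong (toℚᵘ-/ a 0) (toℚᵘ-/ b 0) ⟨
  toℚᵘ (ℤ→ℚ a) ℚᵘ.+ toℚᵘ (ℤ→ℚ b) ≈⟨ ℚP.toℚᵘ-homo-+ (ℤ→ℚ a) (ℤ→ℚ b) ⟨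
  toℚᵘ (ℤ→ℚ a ℚ.+ ℤ→ℚ b)         ∎)
  where
  open ℚᵘP.≃-Reasoning
  cross-multiplied : ∀ a b → (a ℤ.+ b) ℤ.* + 1 ≡ (a ℤ.* + 1 ℤ.+ b ℤ.* + 1) ℤ.* + 1
  cross-multiplied = ℤ-Solver.solve-∀

ℤ→ℚ-* : ∀ a b → ℤ→ℚ (a ℤ.* b) ≡ ℤ→ℚ a ℚ.* ℤ→ℚ b
ℤ→ℚ-* a b = ℚP.toℚᵘ-injective (begin
  toℚᵘ (ℤ→ℚ (a ℤ.* b))           ≈⟨ toℚᵘ-/ (a ℤ.* b) 0 ⟩
  mkℚᵘ a 0 ℚᵘ.* mkℚᵘ b 0         ≈⟨ ℚᵘP.*-cong (toℚᵘ-/ a 0) (toℚᵘ-/ b 0) ⟨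
  toℚᵘ (ℤ→ℚ a) ℚᵘ.* toℚᵘ (ℤ→ℚ b) ≈⟨ ℚP.toℚᵘ-homo-* (ℤ→ℚ a) (ℤ→ℚ b) ⟨
  toℚᵘ (ℤ→ℚ a ℚ.* ℤ→ℚ b)         ∎)
  where open ℚᵘP.≃-Reasoning

ℤ→ℚ-mono-≤ : ∀ {a b} → a ℤ.≤ b → ℤ→ℚ a ℚ.≤ ℤ→ℚ b
ℤ→ℚ-mono-≤ {a} {b} a≤b = ℚP.toℚᵘ-cancel-≤ (begin
  toℚᵘ (ℤ→ℚ a) ≃⟨ toℚᵘ-/ a 0 ⟩
  mkℚᵘ a 0     ≤⟨ *≤* (ℤP.*-monoʳ-≤-nonNeg (+ 1) a≤b) ⟩
  mkℚᵘ b 0     ≃⟨ toℚᵘ-/ b 0 ⟨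
  toℚᵘ (ℤ→ℚ b) ∎)
  where open ℚᵘP.≤-Reasoning

/-*-cancel : ∀ z d → (z ℚ./ suc d) ℚ.* ℤ→ℚ (+ suc d) ≡ ℤ→ℚ z
/-*-cancel z d = ℚP.toℚᵘ-injective (begin
  toℚᵘ ((z ℚ./ suc d) ℚ.* ℤ→ℚ (+ suc d))          ≈⟨ ℚP.toℚᵘ-homo-* (z ℚ./ suc d) (ℤ→ℚ (+ suc d)) ⟩
  toℚᵘ (z ℚ./ suc d) ℚᵘ.* toℚᵘ (ℤ→ℚ (+ suc d))   ≈⟨ ℚᵘP.*-cong (toℚᵘ-/ z d) (toℚᵘ-/ (+ suc d) 0) ⟩
  mkℚᵘ z d ℚᵘ.* mkℚᵘ (+ suc d) 0                  ≈⟨ *≡* (cross-multiplied z d) ⟩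
  mkℚᵘ z 0                                        ≈⟨ toℚᵘ-/ z 0 ⟨
  toℚᵘ (ℤ→ℚ z)                                    ∎)
  where
  open ℚᵘP.≃-Reasoning
  cross-multiplied : ∀ z d → (z ℤ.* + suc d) ℤ.* + 1 ≡ z ℤ.* + suc (d * 1)
  cross-multiplied z d rewrite *-identityʳ d = ℤP.*-identityʳ (z ℤ.* + suc d)

ℕ→ℚ-+ : ∀ m n → ℕ→ℚ (m + n) ≡ ℕ→ℚ m ℚ.+ ℕ→ℚ n
ℕ→ℚ-+ m n = trans (cong ℤ→ℚ (ℤP.pos-+ m n)) (ℤ→ℚ-+ (+ m) (+ n))

ℕ→ℚ-* : ∀ m n → ℕ→ℚ (m * n) ≡ ℕ→ℚ m ℚ.* ℕ→ℚ n
ℕ→ℚ-* m n = trans (cong ℤ→ℚ (ℤP.pos-* m n)) (ℤ→ℚ-* (+ m) (+ n))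

ℕ→ℚ-^ : ∀ m j → ℕ→ℚ (m ^ j) ≡ ℕ→ℚ m ^ℚ j
ℕ→ℚ-^ m zero    = refl
ℕ→ℚ-^ m (suc j) = trans (ℕ→ℚ-* m (m ^ j)) (cong (ℕ→ℚ m ℚ.*_) (ℕ→ℚ-^ m j))

ℕ→ℚ-mono-≤ : ∀ {m n} → m ≤ n → ℕ→ℚ m ℚ.≤ ℕ→ℚ n
ℕ→ℚ-mono-≤ m≤n = ℤ→ℚ-mono-≤ (ℤ.+≤+ m≤n)

^ℚ-distribʳ-* : ∀ p q j → (p ℚ.* q) ^ℚ j ≡ p ^ℚ j ℚ.* q ^ℚ j
^ℚ-distribʳ-* p q zero    = refl
^ℚ-distribʳ-* p q (suc j) rewrite ^ℚ-distribʳ-* p q j =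
  solve 4 (λ p q a b → (p :* q) :* (a :* b) := (p :* a) :* (q :* b)) refl p q (p ^ℚ j) (q ^ℚ j)
  where open ℚ-Solver.+-*-Solver

binomℚ-suc-scaled : ∀ x r j →
  binomℚ x (suc j) ℚ.* ℕ→ℚ (r ^ suc j * suc j !) ≡ binomℚ x j ℚ.* ℕ→ℚ (r ^ j * j !) ℚ.* (ℕ→ℚ r ℚ.* (x ℚ.- ℕ→ℚ j))
binomℚ-suc-scaled x r j = begin
  b ℚ.* d ℚ.* e ℚ.* ℕ→ℚ (r * r ^ j * (suc j * j !))
    ≡⟨ cong (b ℚ.* d ℚ.* e ℚ.*_) (trans (ℕ→ℚ-* (r * r ^ j) (suc j * j !))
         (cong₂ ℚ._*_ (ℕ→ℚ-* r (r ^ j)) (ℕ→ℚ-* (suc j) (j !)))) ⟩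
  b ℚ.* d ℚ.* e ℚ.* (R ℚ.* A ℚ.* (S ℚ.* F))
    ≡⟨ solve 7 (λ b d e R A S F → b :* d :* e :* (R :* A :* (S :* F)) := b :* (A :* F) :* (R :* d) :* (e :* S))
         refl b d e R A S F ⟩
  b ℚ.* (A ℚ.* F) ℚ.* (R ℚ.* d) ℚ.* (e ℚ.* S)
    ≡⟨ cong₂ (λ s t → b ℚ.* s ℚ.* (R ℚ.* d) ℚ.* t) (sym (ℕ→ℚ-* (r ^ j) (j !))) (/-*-cancel (+ 1) j) ⟩
  b ℚ.* ℕ→ℚ (r ^ j * j !) ℚ.* (R ℚ.* d) ℚ.* ℚ.1ℚ
    ≡⟨ ℚP.*-identityʳ _ ⟩
  b ℚ.* ℕ→ℚ (r ^ j * j !) ℚ.* (R ℚ.* d) ∎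
  where
  open ≡-Reasoning
  open ℚ-Solver.+-*-Solver
  b = binomℚ x j
  d = x ℚ.- ℕ→ℚ j
  e = + 1 ℚ./ suc j
  R = ℕ→ℚ r
  A = ℕ→ℚ (r ^ j)
  S = ℕ→ℚ (suc j)
  F = ℕ→ℚ (j !)

cancel-common-power : ∀ ρ a P N R .{{_ : NonZero R}} (B : ℚ) → B ℚ.* ℕ→ℚ R ≡ ℕ→ℚ P →
  a * P ^ ρ ≤ (N * R) ^ ρ → ℕ→ℚ N ^ℚ ρ ℚ.≥ ℕ→ℚ a ℚ.* B ^ℚ ρ
cancel-common-power ρ a P N R B B*R≡P a*P^ρ≤ = ℚP.*-cancelʳ-≤-pos (ℕ→ℚ R ^ℚ ρ) {{R^ρ>0}} (begin
  ℕ→ℚ a ℚ.* B ^ℚ ρ ℚ.* ℕ→ℚ R ^ℚ ρ   ≡⟨ ℚP.*-assoc (ℕ→ℚ a) (B ^ℚ ρ) (ℕ→ℚ R ^ℚ ρ) ⟩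
  ℕ→ℚ a ℚ.* (B ^ℚ ρ ℚ.* ℕ→ℚ R ^ℚ ρ) ≡⟨ cong (ℕ→ℚ a ℚ.*_) (^ℚ-distribʳ-* B (ℕ→ℚ R) ρ) ⟨
  ℕ→ℚ a ℚ.* (B ℚ.* ℕ→ℚ R) ^ℚ ρ      ≡⟨ cong (λ t → ℕ→ℚ a ℚ.* t ^ℚ ρ) B*R≡P ⟩
  ℕ→ℚ a ℚ.* ℕ→ℚ P ^ℚ ρ              ≡⟨ trans (ℕ→ℚ-* a (P ^ ρ)) (cong (ℕ→ℚ a ℚ.*_) (ℕ→ℚ-^ P ρ)) ⟨
  ℕ→ℚ (a * P ^ ρ)                  ≤⟨ ℕ→ℚ-mono-≤ a*P^ρ≤ ⟩
  ℕ→ℚ ((N * R) ^ ρ)                ≡⟨ trans (ℕ→ℚ-^ (N * R) ρ) (cong (_^ℚ ρ) (ℕ→ℚ-* N R)) ⟩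
  (ℕ→ℚ N ℚ.* ℕ→ℚ R) ^ℚ ρ           ≡⟨ ^ℚ-distribʳ-* (ℕ→ℚ N) (ℕ→ℚ R) ρ ⟩
  ℕ→ℚ N ^ℚ ρ ℚ.* ℕ→ℚ R ^ℚ ρ        ∎)
  where
  open ℚP.≤-Reasoning
  R^ρ>0 : ℚ.Positive (ℕ→ℚ R ^ℚ ρ)
  R^ρ>0 = subst ℚ.Positive (ℕ→ℚ-^ R ρ) (ℚP.normalize-pos (R ^ ρ) 1 {{_}} {{m^n≢0 R ρ}})

module _ (u₀ ρ k : ℕ) where

  private
    r = suc ρ
    w = u u₀ r (+ k - + 1) /ℕ r

  r*[w+s-j]≡term : ∀ e j → ℕ→ℚ r ℚ.* (w ℚ.+ ℕ→ℚ (e + suc j) ℚ.- ℕ→ℚ j) ≡ ℕ→ℚ (term u₀ r (e + k))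
  r*[w+s-j]≡term e j = begin
    ℕ→ℚ r ℚ.* (w ℚ.+ ℕ→ℚ (e + suc j) ℚ.- ℕ→ℚ j)
      ≡⟨ cong (λ t → ℕ→ℚ r ℚ.* (w ℚ.+ t ℚ.- ℕ→ℚ j))
           (trans (cong ℕ→ℚ (trans (+-comm e (suc j)) (sym (+-suc j e)))) (ℕ→ℚ-+ j (suc e))) ⟩
    ℕ→ℚ r ℚ.* (w ℚ.+ (ℕ→ℚ j ℚ.+ ℕ→ℚ (suc e)) ℚ.- ℕ→ℚ j)
      ≡⟨ solve 4 (λ R w J E → R :* (w :+ (J :+ E) :- J) := w :* R :+ R :* E) refl (ℕ→ℚ r) w (ℕ→ℚ j) (ℕ→ℚ (suc e)) ⟩
    w ℚ.* ℕ→ℚ r ℚ.+ ℕ→ℚ r ℚ.* ℕ→ℚ (suc e)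
      ≡⟨ cong₂ ℚ._+_ (/-*-cancel z ρ) (sym (ℤ→ℚ-* (+ r) (+ suc e))) ⟩
    ℤ→ℚ z ℚ.+ ℤ→ℚ (+ r ℤ.* + suc e)
      ≡⟨ ℤ→ℚ-+ z (+ r ℤ.* + suc e) ⟨
    ℤ→ℚ (z ℤ.+ + r ℤ.* + suc e)
      ≡⟨ cong ℤ→ℚ z+r*[1+e]≡term ⟩
    ℕ→ℚ (term u₀ r (e + k)) ∎
    where
    open ≡-Reasoning
    open ℚ-Solver.+-*-Solver
    z = u u₀ r (+ k - + 1)
    shift : ∀ U K E R → U ℤ.+ (K ℤ.- + 1) ℤ.* R ℤ.+ R ℤ.* (+ 1 ℤ.+ E) ≡ U ℤ.+ (E ℤ.+ K) ℤ.* R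
    shift = ℤ-Solver.solve-∀
    z+r*[1+e]≡term : z ℤ.+ + r ℤ.* + suc e ≡ + (term u₀ r (e + k))
    z+r*[1+e]≡term = begin
      z ℤ.+ + r ℤ.* + suc e          ≡⟨ shift (+ u₀) (+ k) (+ e) (+ r) ⟩
      + u₀ ℤ.+ (+ e ℤ.+ + k) ℤ.* + r ≡⟨ cong (λ t → + u₀ ℤ.+ t ℤ.* + r) (ℤP.pos-+ e k) ⟨
      + u₀ ℤ.+ + (e + k) ℤ.* + r     ≡⟨ cong (λ t → + u₀ ℤ.+ t) (ℤP.pos-* (e + k) r) ⟨
      + u₀ ℤ.+ + ((e + k) * r)       ≡⟨ ℤP.pos-+ u₀ ((e + k) * r) ⟨
      + (term u₀ r (e + k))          ∎

  binomℚ-∏terms : ∀ s j e → e + j ≡ s →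
    binomℚ (w ℚ.+ ℕ→ℚ s) j ℚ.* ℕ→ℚ (r ^ j * j !) ≡ ℕ→ℚ (∏terms u₀ r (e + k) j)
  binomℚ-∏terms s zero    e _    = refl
  binomℚ-∏terms s (suc j) e refl = begin
    binomℚ x (suc j) ℚ.* ℕ→ℚ (r ^ suc j * suc j !)
      ≡⟨ binomℚ-suc-scaled x r j ⟩
    binomℚ x j ℚ.* ℕ→ℚ (r ^ j * j !) ℚ.* (ℕ→ℚ r ℚ.* (x ℚ.- ℕ→ℚ j))
      ≡⟨ cong₂ ℚ._*_ (binomℚ-∏terms s j (suc e) (sym (+-suc e j))) (r*[w+s-j]≡term e j) ⟩
    ℕ→ℚ (∏terms u₀ r (suc e + k) j) ℚ.* ℕ→ℚ (term u₀ r (e + k))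
      ≡⟨ trans (ℚP.*-comm (ℕ→ℚ (∏terms u₀ r (suc e + k) j)) (ℕ→ℚ (term u₀ r (e + k))))
           (sym (ℕ→ℚ-* (term u₀ r (e + k)) (∏terms u₀ r (suc e + k) j))) ⟩
    ℕ→ℚ (∏terms u₀ r (e + k) (suc j)) ∎
    where
    open ≡-Reasoning
    x = w ℚ.+ ℕ→ℚ (e + suc j)

  binomℚ-bound : ∀ M N → r ^ (M * r) * ∏terms u₀ r k (suc M) ^ ρ ≤ (N * (r ^ suc M * suc M !)) ^ ρ →
    ℕ→ℚ N ^ℚ ρ ℚ.≥ ℕ→ℚ (r ^ (M * r)) ℚ.* binomℚ (w ℚ.+ ℕ→ℚ (suc M)) (suc M) ^ℚ ρ
  binomℚ-bound M N = cancel-common-power ρ (r ^ (M * r)) (∏terms u₀ r k (suc M)) N (r ^ suc M * suc M !)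
    {{m*n≢0 (r ^ suc M) (suc M !) {{m^n≢0 r (suc M)}} {{suc M !≢0}}}}
    (binomℚ (w ℚ.+ ℕ→ℚ (suc M)) (suc M)) (binomℚ-∏terms (suc M) (suc M) 0 refl)

corollary3p3 : (u0 r n k : ℕ) → 1 ≤ u0 → 2 ≤ r → gcd u0 r ≡ 1 → k ≤ n →
    (ℕ→ℚ (L u0 r n)) ^ℚ (r ∸ 1)
      ℚ.≥ ℕ→ℚ (r ^ ((n ∸ k) * r))
          ℚ.* (binomℚ (u u0 r (+ k - + 1) /ℕ r ℚ.+ ℕ→ℚ (suc (n ∸ k))) (suc (n ∸ k))) ^ℚ (r ∸ 1)
corollary3p3 u0 r@(suc ρ@(suc _)) n k 1≤u0 (s≤s 1≤ρ) gcd≡1 k≤n with m≤n⇒∃[o]m+o≡n k≤n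
... | M , refl rewrite m+n∸m≡n k M =
  binomℚ-bound u0 ρ k M (L u0 r (k + M)) (∏terms-bound u0 ρ k M 1≤u0 1≤ρ (gcd≡1⇒coprime gcd≡1))
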